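{- Let $H=(V,E)$ be a hypergraph and $F$ an edge cut of $H$. Then $F$ is a minimal edge cut if and only if every edge of $F$ intersects each connected component of $H \backslash F$ (that is, $f\cap V(H')\neq\emptyset$ for every $f\in F$ and every connected component $H'$ of $H\backslash F$).
   Context: A hypergraph $H=(V,E)$ consists of a non-empty finite set $V$ and a finite multiset $E$ of subsets of $V$ (edges). Distinct vertices are adjacent if some edge contains both; a walk is a sequence of vertices and edges in which consecutive vertices are adjacent via the edge between them; $H$ is connected if any two vertices are joined by a walk; the connected components of $H$ are its maximal connected subhypergraphs without empty edges. For $F\subseteq E$, $H\backslash F=(V,E-F)$. For $S,T\subseteq V$, $[S,T]_H=\{e\in E: e\cap S\neq\emptyset,\ e\cap T\neq\emptyset\}$. An edge cut of $H$ is a set of the form $[S,V-S]_H$ for some non-empty proper subset $S$ of $V$; it is minimal if it does not properly contain another edge cut of $H$. -}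

module Defs where

open import Data.Nat using (ℕ)
open import Data.Fin using (Fin)
open import Data.Fin.Subset using (Subset; _∈_; _∉_; ∁; _⊆_)
open import Data.Product using (Σ; _×_; ∃)
open import Relation.Binary.PropositionalEquality using (_≡_)
open import Relation.Nullary using (¬_)
open import Function.Bundles using (_⇔_)
open import Level using (0ℓ)
open import Relation.Unary using (Pred)

-- A hypergraph with vertex set Fin n and an edge multiset given as an
-- indexed family of m edges  E : Fin m → Subset n  (repetitions allowed).
-- A sub(multi)set of edges is a set of edge indices  F : Subset m.

Meets : ∀ {n} → Subset n → Pred (Fin n) 0ℓ → Set
Meets {n} A P = ∃ λ (v : Fin n) → v ∈ A × P v

_∈ₛ_ : ∀ {n} → Fin n → Subset n → Set
v ∈ₛ S = v ∈ S

Crosses : ∀ {n m} → (Fin m → Subset n) → Subset n → Fin m → Set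
Crosses E S i = Meets (E i) (_∈ₛ S) × Meets (E i) (_∈ₛ ∁ S)

IsEdgeCut : ∀ {n m} → (Fin m → Subset n) → Subset m → Set
IsEdgeCut {n} {m} E F =
  ∃ λ (S : Subset n) →
    (∃ λ v → v ∈ S) × (∃ λ v → v ∈ ∁ S) × (∀ (i : Fin m) → (i ∈ F ⇔ Crosses E S i))

IsMinimalEdgeCut : ∀ {n m} → (Fin m → Subset n) → Subset m → Set
IsMinimalEdgeCut E F =
  IsEdgeCut E F × (∀ F' → IsEdgeCut E F' → F' ⊆ F → F ⊆ F')

data Walk {n m} (E : Fin m → Subset n) (F : Subset m) : Fin n → Fin n → Set where
  here : ∀ {v} → Walk E F v v
  step : ∀ {u w v} (i : Fin m) → i ∉ F → ¬ (u ≡ w) → u ∈ E i → w ∈ E i →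
         Walk E F w v → Walk E F u v

ComponentOf : ∀ {n m} → (Fin m → Subset n) → Subset m → Fin n → Pred (Fin n) 0ℓ
ComponentOf E F v u = Walk E F u v

-- For a vertex v let C be the vertex set of the component of v in H \ F.
-- No edge outside F crosses C, and an edge f ∈ F cannot have both of its ends (one on
-- each side of the cut) in C, so the edges crossing C form an edge cut contained in F.
-- If F is minimal this cut is F itself, so f crosses C and in particular meets it.
-- Conversely, if every f ∈ F meets every component and F' ⊆ F is a cut with sides T and
-- its complement, walks in H \ F never cross T, so the components of a vertex t ∈ T and
-- of a vertex t' ∉ T lie on opposite sides; f meets both, hence crosses T and f ∈ F'.
module Submission where

open import Defs
open import Data.Nat using (ℕ; zero; suc; _+_; _<_; _≤_)
open import Data.Nat.Properties using (≤-trans; +-suc; +-monoʳ-≤; m≤m+n; <⇒≱)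
open import Data.Fin using (Fin; _≟_)
open import Data.Fin.Properties using (any?)
open import Data.Fin.Subset using (Subset; _∈_; _∉_; ∁; _⊆_; _∪_; ⁅_⁆; ∣_∣)
open import Data.Fin.Subset.Properties
  using (_∈?_; x∈∁p⇒x∉p; x∉p⇒x∈∁p; p⊆p∪q; x∈p∪q⁺; x∈p∪q⁻; x∈⁅x⁆; x∈⁅y⁆⇒x≡y; p⊂q⇒∣p∣<∣q∣; ∣p∣≤n)
open import Data.Vec using (tabulate)
open import Data.Vec.Properties using ([]=⇒lookup; lookup⇒[]=; lookup∘tabulate)
open import Data.Product using (_×_; _,_; ∃; proj₁)
open import Data.Sum using (inj₁; inj₂)
open import Function using (_∘_)
open import Function.Bundles using (_⇔_; mk⇔; Equivalence)
open import Level using (0ℓ)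
open import Relation.Binary using (Rel)
open import Relation.Binary.PropositionalEquality using (refl; sym; trans; subst)
open import Relation.Nullary using (Dec; yes; no; does; contradiction)
open import Relation.Nullary.Decidable using (_×-dec_; ¬?; decidable-stable; dec-true)
open import Relation.Unary using (Pred; Decidable)

private
  variable
    n m : ℕ

decSubset : {P : Pred (Fin n) 0ℓ} → Decidable P → Subset n
decSubset P? = tabulate (does ∘ P?)

∈-decSubset⇔ : {P : Pred (Fin n) 0ℓ} (P? : Decidable P) {x : Fin n} → x ∈ decSubset P? ⇔ P x
∈-decSubset⇔ {P = P} P? {x} = mk⇔ to from
  where
    to : x ∈ decSubset P? → P x
    to x∈ with P? x | trans (sym (lookup∘tabulate (does ∘ P?) x)) ([]=⇒lookup x∈)
    ... | yes p | _ = p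
    ... | no _  | ()

    from : P x → x ∈ decSubset P?
    from p = lookup⇒[]= x _ (trans (lookup∘tabulate (does ∘ P?) x) (dec-true (P? x) p))

∣p∣<∣p∪⁅x⁆∣ : {p : Subset n} {x : Fin n} → x ∉ p → ∣ p ∣ < ∣ p ∪ ⁅ x ⁆ ∣
∣p∣<∣p∪⁅x⁆∣ {x = x} x∉p = p⊂q⇒∣p∣<∣q∣ (p⊆p∪q ⁅ x ⁆ , x , x∈p∪q⁺ (inj₂ (x∈⁅x⁆ x)) , x∉p)

-- One missing successor is added at a time; as ∣ X ∣ ≤ n, fuel k with n ≤ k + ∣ X ∣ suffices.
module Saturation {n : ℕ} (_↝_ : Rel (Fin n) 0ℓ) (_↝?_ : ∀ u w → Dec (u ↝ w))
                  (P : Pred (Fin n) 0ℓ) (↝-preserves-P : ∀ {u w} → P u → u ↝ w → P w) where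

  Saturated : Subset n → Set
  Saturated C = ∀ {u w} → u ∈ C → u ↝ w → w ∈ C

  Saturation : Subset n → Set
  Saturation X = ∃ λ C → X ⊆ C × (∀ {u} → u ∈ C → P u) × Saturated C

  saturate : (X : Subset n) → (∀ {u} → u ∈ X → P u) → Saturation X
  saturate X = go n X (m≤m+n n ∣ X ∣)
    where
      go : ∀ k X → n ≤ k + ∣ X ∣ → (∀ {u} → u ∈ X → P u) → Saturation X
      go k X bound X⊆P
        with any? (λ u → any? λ w → (u ∈? X) ×-dec (u ↝? w) ×-dec ¬? (w ∈? X))
      ... | no none = X , (λ x → x) , X⊆P ,
        λ {u} {w} u∈X u↝w → decidable-stable (w ∈? X) (λ w∉X → none (u , w , u∈X , u↝w , w∉X))
      go zero X bound X⊆P | yes (_ , w , _ , _ , w∉X) =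
        contradiction bound (<⇒≱ (≤-trans (∣p∣<∣p∪⁅x⁆∣ w∉X) (∣p∣≤n (X ∪ ⁅ w ⁆))))
      go (suc k) X bound X⊆P | yes (u , w , u∈X , u↝w , w∉X)
        with go k (X ∪ ⁅ w ⁆) bound′ Y⊆P
        where
          bound′ : n ≤ k + ∣ X ∪ ⁅ w ⁆ ∣
          bound′ = ≤-trans bound (subst (_≤ k + ∣ X ∪ ⁅ w ⁆ ∣) (+-suc k ∣ X ∣) (+-monoʳ-≤ k (∣p∣<∣p∪⁅x⁆∣ w∉X)))

          Y⊆P : ∀ {x} → x ∈ X ∪ ⁅ w ⁆ → P x
          Y⊆P {x} x∈Y with x∈p∪q⁻ X ⁅ w ⁆ x∈Y
          ... | inj₁ x∈X = X⊆P x∈X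
          ... | inj₂ x∈⁅w⁆ = subst P (sym (x∈⁅y⁆⇒x≡y w x∈⁅w⁆)) (↝-preserves-P (X⊆P u∈X) u↝w)
      ... | C , Y⊆C , C⊆P , saturated = C , Y⊆C ∘ p⊆p∪q ⁅ w ⁆ , C⊆P , saturated

module _ (E : Fin m → Subset n) where

  Linked : Subset m → Rel (Fin n) 0ℓ
  Linked F u w = ∃ λ i → i ∉ F × u ∈ E i × w ∈ E i

  linked? : ∀ F u w → Dec (Linked F u w)
  linked? F u w = any? λ i → ¬? (i ∈? F) ×-dec (u ∈? E i) ×-dec (w ∈? E i)

  walk-extend : ∀ {F u w v} → Walk E F u v → Linked F u w → Walk E F w v
  walk-extend {u = u} {w} walk (i , i∉F , u∈Ei , w∈Ei) with w ≟ u
  ... | yes refl = walk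
  ... | no w≢u  = step i i∉F w≢u w∈Ei u∈Ei walk

  component : ∀ F v → ∃ λ C → v ∈ C × (∀ {u} → u ∈ C → Walk E F u v)
                            × (∀ {u w} → u ∈ C → Linked F u w → w ∈ C)
  component F v with saturate ⁅ v ⁆ (λ {u} u∈⁅v⁆ → subst (λ x → Walk E F x v) (sym (x∈⁅y⁆⇒x≡y v u∈⁅v⁆)) here)
    where open Saturation (Linked F) (linked? F) (λ u → Walk E F u v) walk-extend
  ... | C , ⁅v⁆⊆C , C⊆component , saturated = C , ⁅v⁆⊆C (x∈⁅x⁆ v) , C⊆component , saturated

  crosses? : ∀ X i → Dec (Crosses E X i)
  crosses? X i = any? (λ v → (v ∈? E i) ×-dec (v ∈? X)) ×-dec any? (λ v → (v ∈? E i) ×-dec (v ∈? ∁ X))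

  crossingEdges : Subset n → Subset m
  crossingEdges X = decSubset (crosses? X)

  ∈-crossingEdges⇔ : ∀ X {i} → i ∈ crossingEdges X ⇔ Crosses E X i
  ∈-crossingEdges⇔ X = ∈-decSubset⇔ (crosses? X)

  module _ {G : Subset m} {X : Subset n} (crossing⇒∈G : ∀ i → Crosses E X i → i ∈ G) where

    walk-preserves : ∀ {u v} → Walk E G u v → u ∈ X → v ∈ X
    walk-preserves here u∈X = u∈X
    walk-preserves (step {u} {w} i i∉G _ u∈Ei w∈Ei walk) u∈X with w ∈? X
    ... | yes w∈X = walk-preserves walk w∈X
    ... | no w∉X  = contradiction (crossing⇒∈G i ((u , u∈Ei , u∈X) , (w , w∈Ei , x∉p⇒x∈∁p w∉X))) i∉G

    walk-reflects : ∀ {u v} → Walk E G u v → v ∈ X → u ∈ X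
    walk-reflects here v∈X = v∈X
    walk-reflects (step {u} {w} i i∉G _ u∈Ei w∈Ei walk) v∈X with u ∈? X
    ... | yes u∈X = u∈X
    ... | no u∉X  = contradiction (crossing⇒∈G i ((w , w∈Ei , walk-reflects walk v∈X) , (u , u∈Ei , x∉p⇒x∈∁p u∉X))) i∉G

  cut-crossing⇒∈ : ∀ {F} → (cut : IsEdgeCut E F) → ∀ i → Crosses E (proj₁ cut) i → i ∈ F
  cut-crossing⇒∈ (_ , _ , _ , ∈F⇔crosses) i = Equivalence.from (∈F⇔crosses i)

  component-misses-cutEdge : ∀ {F C v i} → IsEdgeCut E F → i ∈ F →
                             (∀ {u} → u ∈ C → Walk E F u v) → ∃ λ x → x ∈ ∁ C
  component-misses-cutEdge {C = C} {i = i} cut@(S , _ , _ , ∈F⇔crosses) i∈F C⊆component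
    with Equivalence.to (∈F⇔crosses i) i∈F
  ... | (a , _ , a∈S) , (b , _ , b∈∁S) with a ∈? C | b ∈? C
  ... | no a∉C | _      = a , x∉p⇒x∈∁p a∉C
  ... | _      | no b∉C = b , x∉p⇒x∈∁p b∉C
  ... | yes a∈C | yes b∈C = contradiction (walk-reflects S-sides (C⊆component b∈C) v∈S) (x∈∁p⇒x∉p b∈∁S)
    where
      S-sides = cut-crossing⇒∈ cut
      v∈S = walk-preserves S-sides (C⊆component a∈C) a∈S

  minimal⇒meets-components : ∀ {F} → IsMinimalEdgeCut E F →
                             ∀ i → i ∈ F → ∀ v → Meets (E i) (ComponentOf E F v)
  minimal⇒meets-components {F} (cut , minimal) i i∈F v
    with component F v
  ... | C , v∈C , C⊆component , saturated
    with Equivalence.to (∈-crossingEdges⇔ C) (minimal (crossingEdges C) cut′ crossing⊆F i∈F)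
    where
      crossing⊆F : crossingEdges C ⊆ F
      crossing⊆F {j} j∈ with Equivalence.to (∈-crossingEdges⇔ C) j∈ | j ∈? F
      ... | _ | yes j∈F = j∈F
      ... | (u , u∈Ej , u∈C) , (w , w∈Ej , w∈∁C) | no j∉F =
        contradiction (saturated u∈C (j , j∉F , u∈Ej , w∈Ej)) (x∈∁p⇒x∉p w∈∁C)

      cut′ : IsEdgeCut E (crossingEdges C)
      cut′ = C , (v , v∈C) , component-misses-cutEdge cut i∈F C⊆component , λ _ → ∈-crossingEdges⇔ C
  ... | (u , u∈Ei , u∈C) , _ = u , u∈Ei , C⊆component u∈C

  meets-components⇒minimal : ∀ {F} → IsEdgeCut E F →
                             (∀ i → i ∈ F → ∀ v → Meets (E i) (ComponentOf E F v)) → IsMinimalEdgeCut E F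
  meets-components⇒minimal {F} cut meets = cut , minimal
    where
      minimal : ∀ F′ → IsEdgeCut E F′ → F′ ⊆ F → F ⊆ F′
      minimal F′ cut′@(T , (t , t∈T) , (t′ , t′∈∁T) , ∈F′⇔crosses) F′⊆F {i} i∈F
        with meets i i∈F t | meets i i∈F t′
      ... | a , a∈Ei , a~t | b , b∈Ei , b~t′ =
        Equivalence.from (∈F′⇔crosses i) ((a , a∈Ei , a∈T) , (b , b∈Ei , x∉p⇒x∈∁p b∉T))
        where
          T-sides : ∀ j → Crosses E T j → j ∈ F
          T-sides j = F′⊆F ∘ cut-crossing⇒∈ cut′ j

          a∈T = walk-reflects T-sides a~t t∈T

          b∉T : b ∉ T
          b∉T b∈T = x∈∁p⇒x∉p t′∈∁T (walk-preserves T-sides b~t′ b∈T)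

lemma3p2 : (n m : ℕ) → 0 < n → (E : Fin m → Subset n) → (F : Subset m) →
    IsEdgeCut E F →
    (IsMinimalEdgeCut E F ⇔ (∀ (i : Fin m) → i ∈ F → ∀ (v : Fin n) → Meets (E i) (ComponentOf E F v)))
lemma3p2 _ _ _ E _ cut = mk⇔ (minimal⇒meets-components E) (meets-components⇒minimal E cut)
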